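{- Let $P$ be an augmented program and $M$ a set of atoms, and let $\overline{M}=\sigma_P\setminus M$. Then $P\cup\neg\overline{M}\ \vdash^c_C\ M$ (that is, $P\cup\neg\overline{M}$ is classically consistent and classically entails every atom of $M$) if and only if $M$ is a minimal model of $P$.
   Context: Formulas are propositional over atoms with $\land,\lor,\leftarrow$ (implication) and $\bot$; $\neg F$ abbreviates $\bot\leftarrow F$, $\top$ abbreviates $\bot\leftarrow\bot$. $\sigma_P$ is the set of atoms occurring in $P$. A nested formula is built from atoms, $\bot,\top$ using $\land,\lor,\neg$; an augmented program is a finite set of clauses $H\leftarrow B$ with $H,B$ nested formulas. A set of atoms $M$ is identified with the classical two-valued interpretation making exactly the atoms of $M$ true; $M$ is a model of $P$ if it classically satisfies every clause of $P$, and a minimal model if no proper subset of $M$ is a model of $P$. For a set $X$ of atoms, $\neg X=\{\neg a:a\in X\}$. $T\vdash_C F$ means $(F_1\land\dots\land F_n)\to F$ is a classical tautology for some $F_i\in T$; $T$ is consistent if not $T\vdash_C\bot$; $T\vdash^c_C U$ means $T$ is consistent and $T\vdash_C F$ for all $F\in U$. -}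

module Defs where

open import Data.Bool using (Bool; true; false; _∧_; _∨_; not)
open import Data.List using (List; []; _∷_; _++_; map; filter; concatMap)
open import Data.List.Membership.Propositional using (_∈_)
open import Data.List.Relation.Unary.All using (All)
open import Data.Product using (Σ; _×_)
open import Relation.Binary.PropositionalEquality using (_≡_)
open import Relation.Nullary using (¬_)
open import Data.Bool using (T?)

data Formula (Atom : Set) : Set where
  atom : Atom → Formula Atom
  ⊥f   : Formula Atom
  _∧f_ : Formula Atom → Formula Atom → Formula Atom
  _∨f_ : Formula Atom → Formula Atom → Formula Atom
  _←f_ : Formula Atom → Formula Atom → Formula Atom

module _ {Atom : Set} where
  ¬f : Formula Atom → Formula Atom
  ¬f F = ⊥f ←f F

  ⊤f : Formula Atom
  ⊤f = ⊥f ←f ⊥f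

AtomSet : Set → Set
AtomSet Atom = Atom → Bool

eval : {Atom : Set} → AtomSet Atom → Formula Atom → Bool
eval I (atom a) = I a
eval I ⊥f = false
eval I (F ∧f G) = eval I F ∧ eval I G
eval I (F ∨f G) = eval I F ∨ eval I G
eval I (H ←f B) = not (eval I B) ∨ eval I H

data Nested (Atom : Set) : Set where
  natom : Atom → Nested Atom
  n⊥ n⊤ : Nested Atom
  _n∧_ _n∨_ : Nested Atom → Nested Atom → Nested Atom
  n¬ : Nested Atom → Nested Atom

toF : {Atom : Set} → Nested Atom → Formula Atom
toF (natom a) = atom a
toF n⊥ = ⊥f
toF n⊤ = ⊤f
toF (F n∧ G) = toF F ∧f toF G
toF (F n∨ G) = toF F ∨f toF G
toF (n¬ F) = ¬f (toF F)

atomsN : {Atom : Set} → Nested Atom → List Atom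
atomsN (natom a) = a ∷ []
atomsN n⊥ = []
atomsN n⊤ = []
atomsN (F n∧ G) = atomsN F ++ atomsN G
atomsN (F n∨ G) = atomsN F ++ atomsN G
atomsN (n¬ F) = atomsN F

record Clause (Atom : Set) : Set where
  constructor _⇐_
  field
    head : Nested Atom
    body : Nested Atom

Program : Set → Set
Program Atom = List (Clause Atom)

clauseF : {Atom : Set} → Clause Atom → Formula Atom
clauseF (H ⇐ B) = toF H ←f toF B

-- σ_P: atoms occurring in P (as a list, possibly with repetitions).
σ : {Atom : Set} → Program Atom → List Atom
σ P = concatMap (λ c → atomsN (Clause.head c) ++ atomsN (Clause.body c)) P

IsModel : {Atom : Set} → AtomSet Atom → Program Atom → Set
IsModel M P = All (λ c → eval M (clauseF c) ≡ true) P

_⊆_ : {Atom : Set} → AtomSet Atom → AtomSet Atom → Set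
N ⊆ M = ∀ a → N a ≡ true → M a ≡ true

_⊂_ : {Atom : Set} → AtomSet Atom → AtomSet Atom → Set
N ⊂ M = N ⊆ M × ¬ (∀ a → N a ≡ M a)

IsMinimalModel : {Atom : Set} → AtomSet Atom → Program Atom → Set
IsMinimalModel M P = IsModel M P × (∀ N → N ⊂ M → ¬ IsModel N P)

Theory : Set → Set
Theory Atom = List (Formula Atom)

conj : {Atom : Set} → List (Formula Atom) → Formula Atom
conj [] = ⊤f
conj (F ∷ Fs) = F ∧f conj Fs

Tautology : {Atom : Set} → Formula Atom → Set
Tautology {Atom} F = (I : AtomSet Atom) → eval I F ≡ true

_⊢C_ : {Atom : Set} → Theory Atom → Formula Atom → Set
T ⊢C F = Σ (List _) λ Fs → All (_∈ T) Fs × Tautology (F ←f conj Fs)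

Consistent : {Atom : Set} → Theory Atom → Set
Consistent T = ¬ (T ⊢C ⊥f)

_⊢ᶜC-atoms_ : {Atom : Set} → Theory Atom → AtomSet Atom → Set
T ⊢ᶜC-atoms M = Consistent T × (∀ a → M a ≡ true → T ⊢C atom a)

complementIn : {Atom : Set} → Program Atom → AtomSet Atom → List Atom
complementIn P M = filter (λ a → T? (not (M a))) (σ P)

P∪¬M̄ : {Atom : Set} → Program Atom → AtomSet Atom → Theory Atom
P∪¬M̄ P M = map clauseF P ++ map (λ a → ¬f (atom a)) (complementIn P M)

-- A theory T entails F classically iff every model of T satisfies F (take all of T as
-- premises), so the left-hand side says that P ∪ ¬M̄ is consistent and that all of its
-- models contain M. The models of P ∪ ¬M̄ are the models of P lying inside M on σ_P,
-- and whether I is a model of P depends only on I restricted to σ_P. If there is such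
-- a model and each contains M, it agrees with M on σ_P, so M is a model of P; a model N ⊂ M
-- of P is itself a model of P ∪ ¬M̄, hence contains M. Conversely, if M is a minimal
-- model and I is a model of P ∪ ¬M̄, then M ∩ I agrees with I on σ_P, so it is a model
-- of P inside M, and minimality forces M ⊆ I.
module Submission where

open import Defs
open import Function.Base using (_∘_; case_of_)
open import Function.Bundles using (_⇔_; mk⇔; Equivalence)
open import Data.Bool using (true; false; _∧_; _∨_; not; T?)
open import Data.Bool.Properties using (_≟_; ¬-not; not-¬; T-not-≡)
open import Data.Empty using (⊥-elim)
open import Data.List using (List; []; _∷_; _++_; map)
open import Data.List.Membership.Propositional using (_∈_)
open import Data.List.Membership.Propositional.Properties using (∈-++⁺ˡ; ∈-++⁺ʳ; ∈-filter⁺; ∈-filter⁻)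
open import Data.List.Relation.Unary.All as All using (All; []; _∷_)
open import Data.List.Relation.Unary.All.Properties using (++⁺; ++⁻; map⁺; map⁻)
open import Data.List.Relation.Unary.Any using (here)
open import Data.Product using (∃; _×_; _,_; proj₁; proj₂; uncurry)
open import Relation.Binary.PropositionalEquality using (_≡_; _≢_; refl; sym; trans; cong; cong₂)
open import Relation.Nullary using (¬_; Dec)
open import Relation.Nullary.Decidable using (decidable-stable)

∧-true⁺ : ∀ {x y} → x ≡ true → y ≡ true → x ∧ y ≡ true
∧-true⁺ refl refl = refl

∧-true⁻ : ∀ x {y} → x ∧ y ≡ true → x ≡ true × y ≡ true
∧-true⁻ true refl = refl , refl

→-true⁺ : ∀ x {y} → (x ≡ true → y ≡ true) → not x ∨ y ≡ true
→-true⁺ false h = refl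
→-true⁺ true  h = h refl

→-true⁻ : ∀ {x y} → not x ∨ y ≡ true → x ≡ true → y ≡ true
→-true⁻ h refl = h

≡-true-antisym : ∀ {x y} → (x ≡ true → y ≡ true) → (y ≡ true → x ≡ true) → x ≡ y
≡-true-antisym {false} {false} _ _ = refl
≡-true-antisym {false} {true}  _ h = h refl
≡-true-antisym {true}        h _ = sym (h refl)

module _ {Atom : Set} where

  infix 4 _⊨_ _≗_on_ _⊆_on_
  infixl 30 _∩_

  _⊨_ : AtomSet Atom → Theory Atom → Set
  I ⊨ T = All (λ F → eval I F ≡ true) T

  Satisfiable : Theory Atom → Set
  Satisfiable T = ∃ λ I → I ⊨ T

  _≗_on_ : AtomSet Atom → AtomSet Atom → List Atom → Set
  I ≗ J on xs = ∀ {a} → a ∈ xs → I a ≡ J a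

  _⊆_on_ : AtomSet Atom → AtomSet Atom → List Atom → Set
  I ⊆ J on xs = ∀ {a} → a ∈ xs → I a ≡ true → J a ≡ true

  _∩_ : AtomSet Atom → AtomSet Atom → AtomSet Atom
  (I ∩ J) a = I a ∧ J a

  ∩-⊆ˡ : (I J : AtomSet Atom) → I ∩ J ⊆ I
  ∩-⊆ˡ I J a = proj₁ ∘ ∧-true⁻ (I a)

  ⊆-antisym-on : ∀ {I J xs} → I ⊆ J on xs → J ⊆ I on xs → I ≗ J on xs
  ⊆-antisym-on I⊆J J⊆I a∈xs = ≡-true-antisym (I⊆J a∈xs) (J⊆I a∈xs)

  ≗-++ˡ : ∀ {I J} xs {ys} → I ≗ J on xs ++ ys → I ≗ J on xs
  ≗-++ˡ xs I≗J = I≗J ∘ ∈-++⁺ˡ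

  ≗-++ʳ : ∀ {I J} xs {ys} → I ≗ J on xs ++ ys → I ≗ J on ys
  ≗-++ʳ xs I≗J = I≗J ∘ ∈-++⁺ʳ xs

  eval-cong-on : ∀ {I J} (F : Nested Atom) → I ≗ J on atomsN F →
                 eval I (toF F) ≡ eval J (toF F)
  eval-cong-on (natom a) I≗J = I≗J (here refl)
  eval-cong-on n⊥        I≗J = refl
  eval-cong-on n⊤        I≗J = refl
  eval-cong-on (F n∧ G)  I≗J =
    cong₂ _∧_ (eval-cong-on F (≗-++ˡ (atomsN F) I≗J)) (eval-cong-on G (≗-++ʳ (atomsN F) I≗J))
  eval-cong-on (F n∨ G)  I≗J =
    cong₂ _∨_ (eval-cong-on F (≗-++ˡ (atomsN F) I≗J)) (eval-cong-on G (≗-++ʳ (atomsN F) I≗J))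
  eval-cong-on (n¬ F)    I≗J = cong (λ x → not x ∨ false) (eval-cong-on F I≗J)

  clauseF-cong-on : ∀ {I J} H B → I ≗ J on atomsN H ++ atomsN B →
                    eval I (clauseF (H ⇐ B)) ≡ eval J (clauseF (H ⇐ B))
  clauseF-cong-on H B I≗J =
    cong₂ (λ b h → not b ∨ h) (eval-cong-on B (≗-++ʳ (atomsN H) I≗J))
                              (eval-cong-on H (≗-++ˡ (atomsN H) I≗J))

  isModel-cong-on : ∀ {I J} (P : Program Atom) → I ≗ J on σ P → IsModel I P → IsModel J P
  isModel-cong-on []             I≗J []           = []
  isModel-cong-on ((H ⇐ B) ∷ P) I≗J (I⊨c ∷ I⊨P) =
    trans (sym (clauseF-cong-on H B (≗-++ˡ (atomsN H ++ atomsN B) I≗J))) I⊨c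
      ∷ isModel-cong-on P (≗-++ʳ (atomsN H ++ atomsN B) I≗J) I⊨P

  isModel? : (I : AtomSet Atom) (P : Program Atom) → Dec (IsModel I P)
  isModel? I = All.all? (λ c → eval I (clauseF c) ≟ true)

  ⊨-conj⁺ : ∀ {I} {Fs : List (Formula Atom)} → I ⊨ Fs → eval I (conj Fs) ≡ true
  ⊨-conj⁺ []           = refl
  ⊨-conj⁺ (I⊨F ∷ I⊨Fs) = ∧-true⁺ I⊨F (⊨-conj⁺ I⊨Fs)

  ⊨-conj⁻ : ∀ {I} (Fs : List (Formula Atom)) → eval I (conj Fs) ≡ true → I ⊨ Fs
  ⊨-conj⁻ []       _ = []
  ⊨-conj⁻ (F ∷ Fs) e = let I⊨F , I⊨Fs = ∧-true⁻ _ e in I⊨F ∷ ⊨-conj⁻ Fs I⊨Fs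

  ⊢C-sound : ∀ {T F I} → T ⊢C F → I ⊨ T → eval I F ≡ true
  ⊢C-sound {I = I} (Fs , Fs⊆T , taut) I⊨T =
    →-true⁻ (taut I) (⊨-conj⁺ (All.map (All.lookup I⊨T) Fs⊆T))

  ⊢C-complete : ∀ {T F} → (∀ I → I ⊨ T → eval I F ≡ true) → T ⊢C F
  ⊢C-complete {T} h = T , All.tabulate (λ F∈T → F∈T) , λ I → →-true⁺ _ (h I ∘ ⊨-conj⁻ T)

  satisfiable⇒consistent : ∀ {T} → Satisfiable T → Consistent T
  satisfiable⇒consistent (I , I⊨T) T⊢⊥ = case ⊢C-sound {F = ⊥f} T⊢⊥ I⊨T of λ ()

  consistent⇒¬¬satisfiable : ∀ {T} → Consistent T → ¬ ¬ Satisfiable T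
  consistent⇒¬¬satisfiable con unsat =
    con (⊢C-complete {F = ⊥f} λ I I⊨T → ⊥-elim (unsat (I , I⊨T)))

  ⊢C-atoms⇒⊆-models : ∀ {T M} → (∀ a → M a ≡ true → T ⊢C atom a) → ∀ {I} → I ⊨ T → M ⊆ I
  ⊢C-atoms⇒⊆-models ent I⊨T a Ma = ⊢C-sound {F = atom a} (ent a Ma) I⊨T

  ⊆-models⇒⊢C-atoms : ∀ {T M} → (∀ {I} → I ⊨ T → M ⊆ I) → ∀ a → M a ≡ true → T ⊢C atom a
  ⊆-models⇒⊢C-atoms M⊆models a Ma = ⊢C-complete {F = atom a} λ I I⊨T → M⊆models I⊨T a Ma

  ∈-complementIn⁺ : ∀ P M {a : Atom} → a ∈ σ P → M a ≢ true → a ∈ complementIn P M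
  ∈-complementIn⁺ P M a∈σ Ma≢true =
    ∈-filter⁺ (λ b → T? (not (M b))) a∈σ (Equivalence.from T-not-≡ (¬-not Ma≢true))

  ∈-complementIn⁻ : ∀ P M {a : Atom} → a ∈ complementIn P M → a ∈ σ P × M a ≢ true
  ∈-complementIn⁻ P M a∈M̄ =
    let a∈σ , ¬Ma = ∈-filter⁻ (λ b → T? (not (M b))) {xs = σ P} a∈M̄
    in a∈σ , not-¬ (Equivalence.to T-not-≡ ¬Ma)

  ⊨P∪¬M̄⁺ : ∀ P M {I} → IsModel I P → I ⊆ M on σ P → I ⊨ P∪¬M̄ P M
  ⊨P∪¬M̄⁺ P M {I} I⊨P I⊆M = ++⁺ (map⁺ I⊨P) (map⁺ (All.tabulate I⊨¬a))
    where
    I⊨¬a : ∀ {a} → a ∈ complementIn P M → not (I a) ∨ false ≡ true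
    I⊨¬a {a} a∈M̄ = let a∈σ , Ma≢true = ∈-complementIn⁻ P M a∈M̄ in
      →-true⁺ (I a) (⊥-elim ∘ Ma≢true ∘ I⊆M a∈σ)

  ⊨P∪¬M̄⁻ : ∀ P M {I} → I ⊨ P∪¬M̄ P M → IsModel I P × I ⊆ M on σ P
  ⊨P∪¬M̄⁻ P M {I} I⊨T = map⁻ I⊨P , I⊆M
    where
    I⊨P : I ⊨ map clauseF P
    I⊨P = proj₁ (++⁻ (map clauseF P) I⊨T)

    I⊨¬M̄ : All (λ a → not (I a) ∨ false ≡ true) (complementIn P M)
    I⊨¬M̄ = map⁻ (proj₂ (++⁻ (map clauseF P) I⊨T))

    I⊆M : I ⊆ M on σ P
    I⊆M {a} a∈σ Ia = decidable-stable (M a ≟ true) λ Ma≢true →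
      case →-true⁻ (All.lookup I⊨¬M̄ (∈-complementIn⁺ P M a∈σ Ma≢true)) Ia of λ ()

  minimal-model⇒⊆ : ∀ {P M I} → IsMinimalModel M P → IsModel I P → I ⊆ M on σ P → M ⊆ I
  minimal-model⇒⊆ {P} {M} {I} (_ , minimal) I⊨P I⊆M a Ma =
    decidable-stable (I a ≟ true) λ Ia≢true →
      minimal (M ∩ I) (∩-⊆ˡ M I , M∩I≢M Ia≢true) (isModel-cong-on P I≗M∩I I⊨P)
    where
    M∩I≢M : I a ≢ true → ¬ (∀ b → (M ∩ I) b ≡ M b)
    M∩I≢M Ia≢true M∩I≗M = Ia≢true (proj₂ (∧-true⁻ (M a) (trans (M∩I≗M a) Ma)))

    I≗M∩I : I ≗ M ∩ I on σ P
    I≗M∩I a∈σ = ≡-true-antisym (λ Ib → ∧-true⁺ (I⊆M a∈σ Ib) Ib) (proj₂ ∘ ∧-true⁻ _)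

  ⊆-models⇒minimal-model : ∀ {P M} → Consistent (P∪¬M̄ P M) →
                            (∀ {I} → I ⊨ P∪¬M̄ P M → M ⊆ I) → IsMinimalModel M P
  ⊆-models⇒minimal-model {P} {M} con M⊆models = M⊨P , minimal
    where
    -- Consistency only yields a model up to double negation; IsModel M P is decidable.
    M⊨P : IsModel M P
    M⊨P = decidable-stable (isModel? M P) λ M⊭P → consistent⇒¬¬satisfiable con λ (I , I⊨T) →
      let I⊨P , I⊆M = ⊨P∪¬M̄⁻ P M I⊨T
      in M⊭P (isModel-cong-on P (⊆-antisym-on I⊆M (λ {a} _ → M⊆models I⊨T a)) I⊨P)

    minimal : ∀ N → N ⊂ M → ¬ IsModel N P
    minimal N (N⊆M , N≢M) N⊨P =
      N≢M λ a → ≡-true-antisym (N⊆M a) (M⊆models (⊨P∪¬M̄⁺ P M N⊨P (λ {a} _ → N⊆M a)) a)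

lemma5p1 : {Atom : Set} (P : Program Atom) (M : AtomSet Atom) →
    (P∪¬M̄ P M ⊢ᶜC-atoms M) ⇔ IsMinimalModel M P
lemma5p1 P M = mk⇔
  (λ (con , ent) → ⊆-models⇒minimal-model con (⊢C-atoms⇒⊆-models ent))
  (λ M-minimal@(M⊨P , _) →
      satisfiable⇒consistent (M , ⊨P∪¬M̄⁺ P M M⊨P (λ _ Ma → Ma))
    , ⊆-models⇒⊢C-atoms (uncurry (minimal-model⇒⊆ M-minimal) ∘ ⊨P∪¬M̄⁻ P M))
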